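{- Let $G$ be a simple graph on $n$ vertices and let $J$ be a symmetric subgraph of $K_{n,n}$ with $e_J$ edges. Let $G^1, G^2, \dots$ be the self-similar graphs based on $(G,J)$. Then for every $k \ge 1$, $$e(G^k) = e(G)\left\lceil \frac{n^k - e_J^{\,k}}{n - e_J}\right\rceil \quad \text{if } e_J \neq n,$$ and $e(G^k) = k\, n^{k-1} e(G)$ if $e_J = n$.
   Context: Let $G$ be a simple graph with vertex set $V(G)=\{v_1,\dots,v_n\}$. Let $K_{n,n}$ be the complete bipartite graph with parts $I_n=\{1,\dots,n\}$ and $I_n'=\{1',\dots,n'\}$. A subgraph $J$ of $K_{n,n}$ with vertex set $I_n\cup I_n'$ is symmetric if $i\sim j'$ in $J$ if and only if $j \sim i'$ in $J$. The self-similar graphs based on $(G,J)$ are defined recursively: $G^1=G$; for $k\ge 2$, $V(G^k)=V(G)^k$ (tuples $(v_{i_1},\dots,v_{i_k})$), and $(v_{i_1},\dots,v_{i_k})\sim(v_{j_1},\dots,v_{j_k})$ in $G^k$ if and only if either (1) $(v_{i_1},\dots,v_{i_{k-1}})=(v_{j_1},\dots,v_{j_{k-1}})$ and $v_{i_k}\sim v_{j_k}$ in $G$, or (2) $(v_{i_1},\dots,v_{i_{k-1}})\sim(v_{j_1},\dots,v_{j_{k-1}})$ in $G^{k-1}$ and $i_k\sim j_k'$ in $J$. Here $e(H)$ denotes the number of edges of a graph $H$. -}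

module Defs where

open import Data.Nat as ℕ using (ℕ; zero; suc)
open import Data.Integer as ℤ using (ℤ)
open import Data.Rational as ℚ using (ℚ; 0ℚ; _÷_; ≢-nonZero)
open import Data.Rational.Properties using () renaming (_≟_ to _≟ℚ_)
open import Data.Fin using (Fin)
open import Data.Fin.Properties using () renaming (_≟_ to _≟F_)
open import Data.Bool using (Bool; true; false; _∧_; _∨_; if_then_else_)
open import Data.Unit using (⊤; tt)
open import Data.Product using (_×_; _,_)
open import Data.List using (List; []; _∷_; map; concatMap; length; filterᵇ; allFin; _++_)
open import Relation.Nullary using (yes; no; does)
open import Relation.Binary.PropositionalEquality using (_≡_)

Adj : ℕ → Set
Adj n = Fin n → Fin n → Bool

IsSimple : {n : ℕ} → Adj n → Set
IsSimple {n} A = (∀ i j → A i j ≡ A j i) × (∀ i → A i i ≡ false)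

-- J ⊆ K_{n,n} is encoded by  J i j = true  iff  i ~ j'  in J.
-- J is symmetric: i ~ j'  iff  j ~ i'.
IsSymmetricJ : {n : ℕ} → Adj n → Set
IsSymmetricJ {n} J = ∀ i j → J i j ≡ J j i

pairs : {A : Set} → List A → List (A × A)
pairs [] = []
pairs (x ∷ xs) = map (λ y → (x , y)) xs ++ pairs xs

-- number of edges of a finite graph given by an enumeration (without
-- repetitions) of its vertex set and its adjacency function
edgeCount : {V : Set} → List V → (V → V → Bool) → ℕ
edgeCount vs adj = length (filterᵇ (λ { (u , v) → adj u v }) (pairs vs))

eG : {n : ℕ} → Adj n → ℕ
eG {n} A = edgeCount (allFin n) A

eJ : {n : ℕ} → Adj n → ℕ
eJ {n} J = length (filterᵇ (λ { (i , j) → J i j })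
                    (concatMap (λ i → map (λ j → (i , j)) (allFin n)) (allFin n)))

-- Vertices of G^k: k-tuples (v_{i_1},...,v_{i_k}), built as (prefix , last).
-- Vtx n 0 is the empty tuple; Vtx n k = V(G)^k.
Vtx : ℕ → ℕ → Set
Vtx n zero = ⊤
Vtx n (suc k) = Vtx n k × Fin n

vtxList : (n k : ℕ) → List (Vtx n k)
vtxList n zero = tt ∷ []
vtxList n (suc k) = concatMap (λ u → map (λ a → (u , a)) (allFin n)) (vtxList n k)

eqV : {n : ℕ} (k : ℕ) → Vtx n k → Vtx n k → Bool
eqV zero _ _ = true
eqV (suc k) (u , a) (w , b) = eqV k u w ∧ does (a ≟F b)

-- adjacency of the self-similar graph G^k based on (G, J).
-- At k = 0 (single empty tuple) there are no edges, so that the recursion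
-- yields G^1 ≅ G: (a) ~ (b) iff a ~ b in G.
adjPow : {n : ℕ} → Adj n → Adj n → (k : ℕ) → Vtx n k → Vtx n k → Bool
adjPow G J zero _ _ = false
adjPow G J (suc k) (u , a) (w , b) =
  (eqV k u w ∧ G a b) ∨ (adjPow G J k u w ∧ J a b)

ePow : {n : ℕ} → Adj n → Adj n → ℕ → ℕ
ePow {n} G J k = edgeCount (vtxList n k) (adjPow G J k)

-- total division on ℚ (only used with a nonzero divisor)
_/ℚ_ : ℚ → ℚ → ℚ
p /ℚ q with q ≟ℚ 0ℚ
... | yes _ = 0ℚ
... | no q≢0 = _÷_ p q {{≢-nonZero q≢0}}

ℤtoℚ : ℤ → ℚ
ℤtoℚ m = m ℚ./ 1

module Submission where

-- Count ordered adjacent pairs: for a symmetric loopless adjacency this is twice the number of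
-- edges. An edge of G^(k+1) either lies inside a fibre {u} × V(G) as a copy of an edge of G, or
-- lifts an edge uw of G^k along an edge of J; the two kinds are disjoint since G^k is loopless.
-- Hence e(G^(k+1)) = n^k e(G) + e(G^k) e_J, so e(G^k) = e(G) Σ_{i+j=k-1} n^i e_J^j, which is
-- e(G) (n^k - e_J^k)/(n - e_J) (an integer, so the ceiling is exact) or k n^(k-1) e(G) if e_J = n.

open import Defs
open import Data.Bool using (Bool; true; false; T; _∧_; _∨_)
open import Data.Bool.Properties using (T-∧)
open import Data.Empty using (⊥-elim)
open import Data.Fin using (Fin; zero; suc)
open import Data.Fin.Properties using (_≟_)
open import Data.Integer as ℤ using (+_; -[1+_]; _-_) renaming (_*_ to _*ℤ_; _^_ to _^ℤ_)
import Data.Integer.Properties as ℤ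
open import Data.List using (List; []; _∷_; _++_; map; concatMap; filterᵇ; length; allFin)
open import Data.List.Properties using (map-++; map-cong; map-∘; map-tabulate; length-tabulate)
open import Data.Nat as ℕ using (ℕ; zero; suc; _+_; _*_; _^_; _∸_; _≤_)
open import Data.Nat.Coprimality using (Coprime; 1-coprimeTo) renaming (sym to coprime-sym)
import Data.Nat.DivMod as ℕ
open import Data.Nat.ListAction using (sum)
open import Data.Nat.ListAction.Properties using (sum-++)
import Data.Nat.Properties as ℕ
open import Algebra.Properties.CommutativeSemigroup ℕ.+-commutativeSemigroup using (interchange)
open import Data.Nat.Tactic.RingSolver using (solve-∀)
open import Data.Integer.Tactic.RingSolver using () renaming (solve-∀ to solveℤ-∀)
open import Data.Product using (_×_; _,_; proj₁; proj₂; uncurry)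
open import Data.Rational as ℚ using (mkℚ; ceiling; floor)
import Data.Rational.Properties as ℚ
open import Data.Unit using (tt)
open import Function using (_∘_; id; _$_)
open import Function.Bundles using (Equivalence)
open import Relation.Nullary using (yes; no; does)
open import Relation.Nullary.Decidable using (dec-true; dec-false)
open import Relation.Binary.PropositionalEquality using (_≡_; _≢_; refl; sym; trans; cong; cong₂; module ≡-Reasoning)

private
  variable
    A B : Set

∑ : List A → (A → ℕ) → ℕ
∑ xs f = sum (map f xs)

syntax ∑ xs (λ x → e) = ∑[ x ∈ xs ] e

∑-cong : (xs : List A) {f g : A → ℕ} → (∀ x → f x ≡ g x) → ∑ xs f ≡ ∑ xs g
∑-cong xs f≗g = cong sum (map-cong f≗g xs)

∑-++ : (xs ys : List A) (f : A → ℕ) → ∑ (xs ++ ys) f ≡ ∑ xs f + ∑ ys f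
∑-++ xs ys f = trans (cong sum (map-++ f xs ys)) (sum-++ (map f xs) (map f ys))

∑-map : (h : A → B) (xs : List A) (f : B → ℕ) → ∑ (map h xs) f ≡ ∑ xs (f ∘ h)
∑-map h xs f = cong sum (sym (map-∘ xs))

∑-concatMap : (h : A → List B) (xs : List A) (f : B → ℕ) →
              ∑ (concatMap h xs) f ≡ ∑[ x ∈ xs ] ∑ (h x) f
∑-concatMap h []       f = refl
∑-concatMap h (x ∷ xs) f =
  trans (∑-++ (h x) (concatMap h xs) f) (cong (_+_ (∑ (h x) f)) (∑-concatMap h xs f))

∑-+ : (xs : List A) (f g : A → ℕ) → ∑[ x ∈ xs ] (f x + g x) ≡ ∑ xs f + ∑ xs g
∑-+ []       f g = refl
∑-+ (x ∷ xs) f g =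
  trans (cong (_+_ (f x + g x)) (∑-+ xs f g)) (interchange (f x) (g x) (∑ xs f) (∑ xs g))

∑-*ˡ : (xs : List A) (c : ℕ) (f : A → ℕ) → ∑[ x ∈ xs ] (c * f x) ≡ c * ∑ xs f
∑-*ˡ []       c f = sym (ℕ.*-zeroʳ c)
∑-*ˡ (x ∷ xs) c f = trans (cong (_+_ (c * f x)) (∑-*ˡ xs c f)) (sym (ℕ.*-distribˡ-+ c (f x) (∑ xs f)))

∑-*ʳ : (xs : List A) (c : ℕ) (f : A → ℕ) → ∑[ x ∈ xs ] (f x * c) ≡ ∑ xs f * c
∑-*ʳ xs c f = begin
  ∑[ x ∈ xs ] (f x * c) ≡⟨ ∑-cong xs (λ x → ℕ.*-comm (f x) c) ⟩
  ∑[ x ∈ xs ] (c * f x) ≡⟨ ∑-*ˡ xs c f ⟩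
  c * ∑ xs f            ≡⟨ ℕ.*-comm c (∑ xs f) ⟩
  ∑ xs f * c            ∎
  where open ≡-Reasoning

∑-const : (xs : List A) (c : ℕ) → ∑[ x ∈ xs ] c ≡ length xs * c
∑-const []       c = refl
∑-const (x ∷ xs) c = cong (_+_ c) (∑-const xs c)

∑-1 : (xs : List A) → ∑[ x ∈ xs ] 1 ≡ length xs
∑-1 xs = trans (∑-const xs 1) (ℕ.*-identityʳ (length xs))

∑-zero : (xs : List A) → ∑[ x ∈ xs ] 0 ≡ 0
∑-zero xs = trans (∑-const xs 0) (ℕ.*-zeroʳ (length xs))

∑-swap : (xs : List A) (ys : List B) (f : A → B → ℕ) →
         ∑[ x ∈ xs ] ∑[ y ∈ ys ] f x y ≡ ∑[ y ∈ ys ] ∑[ x ∈ xs ] f x y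
∑-swap []       ys f = sym (∑-zero ys)
∑-swap (x ∷ xs) ys f =
  trans (cong (_+_ (∑ ys (f x))) (∑-swap xs ys f)) (sym (∑-+ ys (f x) (λ y → ∑[ x′ ∈ xs ] f x′ y)))

∑-linear : (xs : List A) (a b : ℕ) (f g : A → ℕ) →
           ∑[ x ∈ xs ] (a * f x + b * g x) ≡ a * ∑ xs f + b * ∑ xs g
∑-linear xs a b f g = trans (∑-+ xs _ _) (cong₂ _+_ (∑-*ˡ xs a f) (∑-*ˡ xs b g))

∑-linearʳ : (xs : List A) (a b : ℕ) (f g : A → ℕ) →
            ∑[ x ∈ xs ] (f x * a + g x * b) ≡ ∑ xs f * a + ∑ xs g * b
∑-linearʳ xs a b f g = trans (∑-+ xs _ _) (cong₂ _+_ (∑-*ʳ xs a f) (∑-*ʳ xs b g))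

∑-allFin-suc : (n : ℕ) (f : Fin (suc n) → ℕ) →
               ∑ (allFin (suc n)) f ≡ f zero + ∑[ a ∈ allFin n ] f (suc a)
∑-allFin-suc n f =
  cong (λ l → f zero + sum l) (trans (map-tabulate suc f) (sym (map-tabulate id (f ∘ suc))))

toℕ : Bool → ℕ
toℕ true  = 1
toℕ false = 0

toℕ-∧ : ∀ x y → toℕ (x ∧ y) ≡ toℕ x * toℕ y
toℕ-∧ true  true  = refl
toℕ-∧ true  false = refl
toℕ-∧ false y     = refl

toℕ-∨-exclusive : ∀ x y z w → (T x → z ≡ false) →
                  toℕ ((x ∧ y) ∨ (z ∧ w)) ≡ toℕ x * toℕ y + toℕ z * toℕ w
toℕ-∨-exclusive true  true  false w _ = refl
toℕ-∨-exclusive true  false false w _ = refl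
toℕ-∨-exclusive true  y     true  w x⇒¬z with () ← x⇒¬z tt
toℕ-∨-exclusive false y     z     w _ = toℕ-∧ z w

length-filterᵇ : (p : A → Bool) (xs : List A) → length (filterᵇ p xs) ≡ ∑[ x ∈ xs ] toℕ (p x)
length-filterᵇ p []       = refl
length-filterᵇ p (x ∷ xs) with p x
... | true  = cong suc (length-filterᵇ p xs)
... | false = length-filterᵇ p xs

arcCount : List A → (A → A → Bool) → ℕ
arcCount vs adj = ∑[ u ∈ vs ] ∑[ v ∈ vs ] toℕ (adj u v)

module _ {adj : A → A → Bool}
         (adj-sym : ∀ u v → adj u v ≡ adj v u) (adj-irrefl : ∀ u → adj u u ≡ false) where

  arcCount-∷ : ∀ x xs → arcCount (x ∷ xs) adj ≡ 2 * ∑[ y ∈ xs ] toℕ (adj x y) + arcCount xs adj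
  arcCount-∷ x xs = begin
    toℕ (adj x x) + row + ∑[ z ∈ xs ] (toℕ (adj z x) + ∑[ y ∈ xs ] toℕ (adj z y))
      ≡⟨ cong₂ _+_ (cong (λ b → toℕ b + row) (adj-irrefl x)) (∑-+ xs _ _) ⟩
    row + (∑[ z ∈ xs ] toℕ (adj z x) + arcCount xs adj)
      ≡⟨ cong (λ c → row + (c + arcCount xs adj)) (∑-cong xs (λ z → cong toℕ (adj-sym z x))) ⟩
    row + (row + arcCount xs adj)
      ≡⟨ sym (ℕ.+-assoc row row _) ⟩
    row + row + arcCount xs adj
      ≡⟨ cong (_+ arcCount xs adj) (cong (_+_ row) (sym (ℕ.+-identityʳ row))) ⟩
    2 * row + arcCount xs adj
      ∎
    where
    open ≡-Reasoning
    row = ∑[ y ∈ xs ] toℕ (adj x y)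

  2*∑pairs≡arcCount : ∀ vs → 2 * ∑ (pairs vs) (toℕ ∘ uncurry adj) ≡ arcCount vs adj
  2*∑pairs≡arcCount []       = refl
  2*∑pairs≡arcCount (x ∷ xs) = begin
    2 * ∑ (map (x ,_) xs ++ pairs xs) (toℕ ∘ uncurry adj)
      ≡⟨ cong (2 *_) (trans (∑-++ (map (x ,_) xs) (pairs xs) _) (cong (_+ _) (∑-map (x ,_) xs _))) ⟩
    2 * (row + ∑ (pairs xs) (toℕ ∘ uncurry adj))
      ≡⟨ ℕ.*-distribˡ-+ 2 row _ ⟩
    2 * row + 2 * ∑ (pairs xs) (toℕ ∘ uncurry adj)
      ≡⟨ cong (_+_ (2 * row)) (2*∑pairs≡arcCount xs) ⟩
    2 * row + arcCount xs adj
      ≡⟨ sym (arcCount-∷ x xs) ⟩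
    arcCount (x ∷ xs) adj
      ∎
    where
    open ≡-Reasoning
    row = ∑[ y ∈ xs ] toℕ (adj x y)

  2*edgeCount≡arcCount : ∀ vs → 2 * edgeCount vs adj ≡ arcCount vs adj
  2*edgeCount≡arcCount vs = trans (cong (2 *_) (length-filterᵇ _ (pairs vs))) (2*∑pairs≡arcCount vs)

length-allFin : ∀ n → length (allFin n) ≡ n
length-allFin n = length-tabulate id

does-≟-sym : ∀ {n} (a b : Fin n) → does (a ≟ b) ≡ does (b ≟ a)
does-≟-sym a b with a ≟ b
... | yes a≡b = sym (dec-true (b ≟ a) (sym a≡b))
... | no  a≢b = sym (dec-false (b ≟ a) (a≢b ∘ sym))

∑-≟ : ∀ {n} (a : Fin n) → ∑[ b ∈ allFin n ] toℕ (does (a ≟ b)) ≡ 1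
∑-≟ {suc n} zero    = trans (∑-allFin-suc n (toℕ ∘ does ∘ (zero ≟_))) (cong suc (∑-zero (allFin n)))
∑-≟ {suc n} (suc a) = trans (∑-allFin-suc n (toℕ ∘ does ∘ (suc a ≟_))) (∑-≟ a)

module _ {n : ℕ} where

  ∑-vtxList-suc : ∀ k (f : Vtx n (suc k) → ℕ) →
                  ∑ (vtxList n (suc k)) f ≡ ∑[ u ∈ vtxList n k ] ∑[ a ∈ allFin n ] f (u , a)
  ∑-vtxList-suc k f =
    trans (∑-concatMap _ (vtxList n k) f) (∑-cong (vtxList n k) (λ u → ∑-map (u ,_) (allFin n) f))

  length-vtxList : ∀ k → length (vtxList n k) ≡ n ^ k
  length-vtxList zero    = refl
  length-vtxList (suc k) = begin
    length (vtxList n (suc k))                ≡⟨ sym (∑-1 (vtxList n (suc k))) ⟩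
    ∑[ v ∈ vtxList n (suc k) ] 1              ≡⟨ ∑-vtxList-suc k _ ⟩
    ∑[ u ∈ vtxList n k ] ∑[ a ∈ allFin n ] 1  ≡⟨ ∑-cong (vtxList n k) (λ _ → ∑-1 (allFin n)) ⟩
    ∑[ u ∈ vtxList n k ] length (allFin n)    ≡⟨ ∑-cong (vtxList n k) (λ _ → length-allFin n) ⟩
    ∑[ u ∈ vtxList n k ] n                    ≡⟨ ∑-const (vtxList n k) n ⟩
    length (vtxList n k) * n                  ≡⟨ cong (_* n) (length-vtxList k) ⟩
    n ^ k * n                                 ≡⟨ ℕ.*-comm (n ^ k) n ⟩
    n ^ suc k                                 ∎
    where open ≡-Reasoning

  eqV-refl : ∀ k (u : Vtx n k) → eqV k u u ≡ true
  eqV-refl zero    u       = refl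
  eqV-refl (suc k) (u , a) = cong₂ _∧_ (eqV-refl k u) (dec-true (a ≟ a) refl)

  eqV-sym : ∀ k (u w : Vtx n k) → eqV k u w ≡ eqV k w u
  eqV-sym zero    u       w       = refl
  eqV-sym (suc k) (u , a) (w , b) = cong₂ _∧_ (eqV-sym k u w) (does-≟-sym a b)

  eqV⇒≡ : ∀ k (u w : Vtx n k) → T (eqV k u w) → u ≡ w
  eqV⇒≡ zero    u       w       _ = refl
  eqV⇒≡ (suc k) (u , a) (w , b) h with a ≟ b
  ... | yes a≡b = cong₂ _,_ (eqV⇒≡ k u w (proj₁ (Equivalence.to T-∧ h))) a≡b
  ... | no  _   = ⊥-elim (proj₂ (Equivalence.to T-∧ h))

  ∑-eqV : ∀ k (u : Vtx n k) → ∑[ w ∈ vtxList n k ] toℕ (eqV k u w) ≡ 1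
  ∑-eqV zero    u       = refl
  ∑-eqV (suc k) (u , a) = begin
    ∑[ v ∈ vtxList n (suc k) ] toℕ (eqV (suc k) (u , a) v)
      ≡⟨ ∑-vtxList-suc k _ ⟩
    ∑[ w ∈ vtxList n k ] ∑[ b ∈ allFin n ] toℕ (eqV k u w ∧ does (a ≟ b))
      ≡⟨ ∑-cong (vtxList n k) (λ w → ∑-cong (allFin n) (λ b → toℕ-∧ (eqV k u w) _)) ⟩
    ∑[ w ∈ vtxList n k ] ∑[ b ∈ allFin n ] (toℕ (eqV k u w) * toℕ (does (a ≟ b)))
      ≡⟨ ∑-cong (vtxList n k) (λ w → ∑-*ˡ (allFin n) (toℕ (eqV k u w)) (toℕ ∘ does ∘ (a ≟_))) ⟩
    ∑[ w ∈ vtxList n k ] (toℕ (eqV k u w) * ∑[ b ∈ allFin n ] toℕ (does (a ≟ b)))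
      ≡⟨ ∑-cong (vtxList n k) (λ w → trans (cong (toℕ (eqV k u w) *_) (∑-≟ a)) (ℕ.*-identityʳ _)) ⟩
    ∑[ w ∈ vtxList n k ] toℕ (eqV k u w)
      ≡⟨ ∑-eqV k u ⟩
    1 ∎
    where open ≡-Reasoning

module _ {n : ℕ} (G J : Adj n) where

  adjPow-sym : (∀ a b → G a b ≡ G b a) → IsSymmetricJ J →
               ∀ k (u w : Vtx n k) → adjPow G J k u w ≡ adjPow G J k w u
  adjPow-sym G-sym J-sym zero    u       w       = refl
  adjPow-sym G-sym J-sym (suc k) (u , a) (w , b) =
    cong₂ _∨_ (cong₂ _∧_ (eqV-sym k u w) (G-sym a b)) (cong₂ _∧_ (adjPow-sym G-sym J-sym k u w) (J-sym a b))

  adjPow-irrefl : (∀ a → G a a ≡ false) → ∀ k (u : Vtx n k) → adjPow G J k u u ≡ false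
  adjPow-irrefl G-irrefl zero    u       = refl
  adjPow-irrefl G-irrefl (suc k) (u , a)
    rewrite eqV-refl k u | G-irrefl a | adjPow-irrefl G-irrefl k u = refl

  arcCount-adjPow-suc : (∀ a → G a a ≡ false) → ∀ k →
    arcCount (vtxList n (suc k)) (adjPow G J (suc k))
      ≡ n ^ k * arcCount (allFin n) G + arcCount (vtxList n k) (adjPow G J k) * arcCount (allFin n) J
  arcCount-adjPow-suc G-irrefl k = begin
    arcCount (vtxList n (suc k)) (H (suc k))
      ≡⟨ ∑-vtxList-suc k _ ⟩
    ∑[ u ∈ Vk ] ∑[ a ∈ F ] ∑[ y ∈ vtxList n (suc k) ] toℕ (H (suc k) (u , a) y)
      ≡⟨ ∑-cong Vk (λ u → ∑-cong F (λ a → ∑-vtxList-suc k _)) ⟩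
    ∑[ u ∈ Vk ] ∑[ a ∈ F ] ∑[ w ∈ Vk ] ∑[ b ∈ F ] toℕ ((eqV k u w ∧ G a b) ∨ (H k u w ∧ J a b))
      ≡⟨ ∑-cong Vk (λ u → ∑-cong F (λ a → ∑-cong Vk (λ w → ∑-cong F (λ b →
           toℕ-∨-exclusive (eqV k u w) (G a b) (H k u w) (J a b) (eqV⇒¬adjPow u w))))) ⟩
    ∑[ u ∈ Vk ] ∑[ a ∈ F ] ∑[ w ∈ Vk ] ∑[ b ∈ F ] (δ u w * toℕ (G a b) + toℕ (H k u w) * toℕ (J a b))
      ≡⟨ ∑-cong Vk (λ u → ∑-swap F Vk _) ⟩
    ∑[ u ∈ Vk ] ∑[ w ∈ Vk ] ∑[ a ∈ F ] ∑[ b ∈ F ] (δ u w * toℕ (G a b) + toℕ (H k u w) * toℕ (J a b))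
      ≡⟨ ∑-cong Vk (λ u → ∑-cong Vk (λ w → ∑-linear₂ (δ u w) (toℕ (H k u w)))) ⟩
    ∑[ u ∈ Vk ] ∑[ w ∈ Vk ] (δ u w * arcCount F G + toℕ (H k u w) * arcCount F J)
      ≡⟨ ∑-cong Vk (λ u → ∑-linearʳ Vk _ _ (δ u) (toℕ ∘ H k u)) ⟩
    ∑[ u ∈ Vk ] (∑ Vk (δ u) * arcCount F G + ∑[ w ∈ Vk ] toℕ (H k u w) * arcCount F J)
      ≡⟨ ∑-linearʳ Vk _ _ (λ u → ∑ Vk (δ u)) (λ u → ∑[ w ∈ Vk ] toℕ (H k u w)) ⟩
    ∑[ u ∈ Vk ] ∑ Vk (δ u) * arcCount F G + arcCount Vk (H k) * arcCount F J
      ≡⟨ cong (λ c → c * arcCount F G + arcCount Vk (H k) * arcCount F J) diagonal ⟩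
    n ^ k * arcCount F G + arcCount Vk (H k) * arcCount F J
      ∎
    where
    open ≡-Reasoning
    H = adjPow G J
    Vk = vtxList n k
    F = allFin n
    δ : Vtx n k → Vtx n k → ℕ
    δ u w = toℕ (eqV k u w)

    eqV⇒¬adjPow : ∀ u w → T (eqV k u w) → H k u w ≡ false
    eqV⇒¬adjPow u w u=w rewrite eqV⇒≡ k u w u=w = adjPow-irrefl G-irrefl k w

    ∑-linear₂ : ∀ c d → ∑[ a ∈ F ] ∑[ b ∈ F ] (c * toℕ (G a b) + d * toℕ (J a b))
                          ≡ c * arcCount F G + d * arcCount F J
    ∑-linear₂ c d = trans (∑-cong F (λ a → ∑-linear F c d (toℕ ∘ G a) (toℕ ∘ J a)))
                          (∑-linear F c d _ _)

    diagonal : ∑[ u ∈ Vk ] ∑ Vk (δ u) ≡ n ^ k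
    diagonal = begin
      ∑[ u ∈ Vk ] ∑ Vk (δ u) ≡⟨ ∑-cong Vk (∑-eqV k) ⟩
      ∑[ u ∈ Vk ] 1          ≡⟨ ∑-1 Vk ⟩
      length Vk              ≡⟨ length-vtxList k ⟩
      n ^ k                  ∎

  eJ≡arcCount : eJ J ≡ arcCount (allFin n) J
  eJ≡arcCount = begin
    eJ J
      ≡⟨ length-filterᵇ _ (concatMap (λ i → map (i ,_) (allFin n)) (allFin n)) ⟩
    ∑ (concatMap (λ i → map (i ,_) (allFin n)) (allFin n)) (toℕ ∘ uncurry J)
      ≡⟨ ∑-concatMap _ (allFin n) _ ⟩
    ∑[ i ∈ allFin n ] ∑ (map (i ,_) (allFin n)) (toℕ ∘ uncurry J)
      ≡⟨ ∑-cong (allFin n) (λ i → ∑-map (i ,_) (allFin n) _) ⟩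
    arcCount (allFin n) J
      ∎
    where open ≡-Reasoning

  ePow-suc : IsSimple G → IsSymmetricJ J → ∀ k → ePow G J (suc k) ≡ n ^ k * eG G + ePow G J k * eJ J
  ePow-suc (G-sym , G-irrefl) J-sym k = ℕ.*-cancelˡ-≡ _ _ 2 $ begin
    2 * ePow G J (suc k)
      ≡⟨ 2*edgeCount≡arcCount (adjPow-sym G-sym J-sym (suc k)) (adjPow-irrefl G-irrefl (suc k))
                              (vtxList n (suc k)) ⟩
    arcCount (vtxList n (suc k)) (adjPow G J (suc k))
      ≡⟨ arcCount-adjPow-suc G-irrefl k ⟩
    n ^ k * arcCount (allFin n) G + arcCount (vtxList n k) (adjPow G J k) * arcCount (allFin n) J
      ≡⟨ cong₂ (λ g e → n ^ k * g + e * arcCount (allFin n) J)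
               (sym (2*edgeCount≡arcCount G-sym G-irrefl (allFin n)))
               (sym (2*edgeCount≡arcCount (adjPow-sym G-sym J-sym k) (adjPow-irrefl G-irrefl k) (vtxList n k))) ⟩
    n ^ k * (2 * eG G) + 2 * ePow G J k * arcCount (allFin n) J
      ≡⟨ cong (λ j → n ^ k * (2 * eG G) + 2 * ePow G J k * j) (sym eJ≡arcCount) ⟩
    n ^ k * (2 * eG G) + 2 * ePow G J k * eJ J
      ≡⟨ factor-2 (n ^ k) (eG G) (ePow G J k) (eJ J) ⟩
    2 * (n ^ k * eG G + ePow G J k * eJ J)
      ∎
    where
    open ≡-Reasoning
    factor-2 : ∀ p g e j → p * (2 * g) + 2 * e * j ≡ 2 * (p * g + e * j)
    factor-2 = solve-∀

geometricSum : ℕ → ℕ → ℕ → ℕ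
geometricSum a b zero    = 0
geometricSum a b (suc k) = a ^ k + b * geometricSum a b k

recurrence⇒≡*geometricSum : (x : ℕ → ℕ) (a b c : ℕ) → x 0 ≡ 0 →
                             (∀ k → x (suc k) ≡ a ^ k * c + x k * b) →
                             ∀ k → x k ≡ c * geometricSum a b k
recurrence⇒≡*geometricSum x a b c x₀ x-suc zero    = trans x₀ (sym (ℕ.*-zeroʳ c))
recurrence⇒≡*geometricSum x a b c x₀ x-suc (suc k) = begin
  x (suc k)                               ≡⟨ x-suc k ⟩
  a ^ k * c + x k * b                     ≡⟨ cong (λ t → a ^ k * c + t * b) x-closed ⟩
  a ^ k * c + c * geometricSum a b k * b  ≡⟨ regroup (a ^ k) c (geometricSum a b k) b ⟩
  c * (a ^ k + b * geometricSum a b k)    ∎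
  where
  open ≡-Reasoning
  x-closed : x k ≡ c * geometricSum a b k
  x-closed = recurrence⇒≡*geometricSum x a b c x₀ x-suc k
  regroup : ∀ p c s b → p * c + c * s * b ≡ c * (p + b * s)
  regroup = solve-∀

geometricSum-diagonal : ∀ a m → geometricSum a a (suc m) ≡ suc m * a ^ m
geometricSum-diagonal a zero    = cong suc (ℕ.*-zeroʳ a)
geometricSum-diagonal a (suc m) = begin
  a ^ suc m + a * geometricSum a a (suc m)   ≡⟨ cong (λ t → a ^ suc m + a * t) (geometricSum-diagonal a m) ⟩
  a * a ^ m + a * (suc m * a ^ m)            ≡⟨ regroup a (a ^ m) m ⟩
  suc (suc m) * (a * a ^ m)                  ∎
  where
  open ≡-Reasoning
  regroup : ∀ a p m → a * p + a * ((1 + m) * p) ≡ (2 + m) * (a * p)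
  regroup = solve-∀

pos-^ : ∀ a k → + (a ^ k) ≡ (+ a) ^ℤ k
pos-^ a zero    = refl
pos-^ a (suc k) = trans (ℤ.pos-* a (a ^ k)) (cong (+ a *ℤ_) (pos-^ a k))

[a-b]*geometricSum≡aᵏ-bᵏ : ∀ a b k → (+ a - + b) *ℤ + geometricSum a b k ≡ (+ a) ^ℤ k - (+ b) ^ℤ k
[a-b]*geometricSum≡aᵏ-bᵏ a b zero    = trans (ℤ.*-zeroʳ (+ a - + b)) (sym (ℤ.+-inverseʳ (+ 1)))
[a-b]*geometricSum≡aᵏ-bᵏ a b (suc k) = begin
  (+ a - + b) *ℤ + (a ^ k + b * geometricSum a b k)
    ≡⟨ cong ((+ a - + b) *ℤ_) (trans (ℤ.pos-+ (a ^ k) _) (cong₂ ℤ._+_ (pos-^ a k) (ℤ.pos-* b _))) ⟩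
  (+ a - + b) *ℤ ((+ a) ^ℤ k ℤ.+ + b *ℤ + geometricSum a b k)
    ≡⟨ distribute (+ a) (+ b) ((+ a) ^ℤ k) (+ geometricSum a b k) ⟩
  (+ a - + b) *ℤ (+ a) ^ℤ k ℤ.+ + b *ℤ ((+ a - + b) *ℤ + geometricSum a b k)
    ≡⟨ cong (λ t → (+ a - + b) *ℤ (+ a) ^ℤ k ℤ.+ + b *ℤ t) ([a-b]*geometricSum≡aᵏ-bᵏ a b k) ⟩
  (+ a - + b) *ℤ (+ a) ^ℤ k ℤ.+ + b *ℤ ((+ a) ^ℤ k - (+ b) ^ℤ k)
    ≡⟨ telescope (+ a) (+ b) ((+ a) ^ℤ k) ((+ b) ^ℤ k) ⟩
  + a *ℤ (+ a) ^ℤ k - + b *ℤ (+ b) ^ℤ k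
    ∎
  where
  open ≡-Reasoning
  distribute : ∀ a b p s → (a - b) *ℤ (p ℤ.+ b *ℤ s) ≡ (a - b) *ℤ p ℤ.+ b *ℤ ((a - b) *ℤ s)
  distribute = solveℤ-∀
  telescope : ∀ a b p q → (a - b) *ℤ p ℤ.+ b *ℤ (p - q) ≡ a *ℤ p - b *ℤ q
  telescope = solveℤ-∀

i/ℕ1≡i : ∀ i → i ℤ./ℕ 1 ≡ i
i/ℕ1≡i (+ m)      = cong +_ (ℕ.n/1≡n m)
i/ℕ1≡i -[1+ m ] with suc m ℕ.% 1 | ℕ.n%1≡0 (suc m)
... | .0 | refl = cong (λ q → ℤ.- (+ q)) (ℕ.n/1≡n (suc m))

floor-mkℚ-1 : ∀ i .(c : Coprime ℤ.∣ i ∣ 1) → floor (mkℚ i 0 c) ≡ i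
floor-mkℚ-1 i c = trans (ℤ.*-identityˡ (i ℤ./ℕ 1)) (i/ℕ1≡i i)

ceiling-mkℚ-1 : ∀ i .(c : Coprime ℤ.∣ i ∣ 1) → ceiling (mkℚ i 0 c) ≡ i
ceiling-mkℚ-1 (+ zero)  c = refl
ceiling-mkℚ-1 (+ suc m) c = cong ℤ.-_ (floor-mkℚ-1 -[1+ m ] c)
ceiling-mkℚ-1 -[1+ m ]  c = cong ℤ.-_ (floor-mkℚ-1 (+ suc m) c)

ℤtoℚ≡mkℚ : ∀ i → ℤtoℚ i ≡ mkℚ i 0 (coprime-sym (1-coprimeTo ℤ.∣ i ∣))
ℤtoℚ≡mkℚ i = ℚ.↥p/↧p≡p (mkℚ i 0 (coprime-sym (1-coprimeTo ℤ.∣ i ∣)))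

ceiling-ℤtoℚ : ∀ i → ceiling (ℤtoℚ i) ≡ i
ceiling-ℤtoℚ i = trans (cong ceiling (ℤtoℚ≡mkℚ i)) (ceiling-mkℚ-1 i _)

ℤtoℚ-* : ∀ i j → ℤtoℚ (i *ℤ j) ≡ ℤtoℚ i ℚ.* ℤtoℚ j
ℤtoℚ-* i j rewrite ℤtoℚ≡mkℚ i | ℤtoℚ≡mkℚ j = refl

ceiling-ℤtoℚ[d*i]/ℤtoℚd : ∀ d i → d ≢ + 0 → ⌈ ℤtoℚ (d *ℤ i) /ℚ ℤtoℚ d ⌉ ≡ i
ceiling-ℤtoℚ[d*i]/ℤtoℚd d i d≢0 with ℤtoℚ d ℚ.≟ ℚ.0ℚ
... | yes d≡0 = ⊥-elim (d≢0 (trans (cong ℚ.↥_ (sym (ℤtoℚ≡mkℚ d))) (ℚ.p≡0⇒↥p≡0 _ d≡0)))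
... | no  d≢0 = trans (cong ceiling cancel) (ceiling-ℤtoℚ i)
  where
  instance _ = ℚ.≢-nonZero d≢0
  cancel : ℤtoℚ (d *ℤ i) ℚ.÷ ℤtoℚ d ≡ ℤtoℚ i
  cancel = begin
    ℤtoℚ (d *ℤ i) ℚ.* ℚ.1/ ℤtoℚ d        ≡⟨ cong (ℚ._* ℚ.1/ ℤtoℚ d) (ℤtoℚ-* d i) ⟩
    ℤtoℚ d ℚ.* ℤtoℚ i ℚ.* ℚ.1/ ℤtoℚ d    ≡⟨ cong (ℚ._* ℚ.1/ ℤtoℚ d) (ℚ.*-comm (ℤtoℚ d) (ℤtoℚ i)) ⟩
    ℤtoℚ i ℚ.* ℤtoℚ d ℚ.* ℚ.1/ ℤtoℚ d    ≡⟨ ℚ.*-assoc (ℤtoℚ i) (ℤtoℚ d) _ ⟩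
    ℤtoℚ i ℚ.* (ℤtoℚ d ℚ.* ℚ.1/ ℤtoℚ d)  ≡⟨ cong (ℤtoℚ i ℚ.*_) (ℚ.*-inverseʳ (ℤtoℚ d)) ⟩
    ℤtoℚ i ℚ.* ℚ.1ℚ                      ≡⟨ ℚ.*-identityʳ (ℤtoℚ i) ⟩
    ℤtoℚ i                               ∎
    where open ≡-Reasoning

module _ {n : ℕ} (G J : Adj n) (G-simple : IsSimple G) (J-sym : IsSymmetricJ J) where

  ePow≡eG*geometricSum : ∀ k → ePow G J k ≡ eG G * geometricSum n (eJ J) k
  ePow≡eG*geometricSum =
    recurrence⇒≡*geometricSum (ePow G J) n (eJ J) (eG G) refl (ePow-suc G J G-simple J-sym)

  ePow-eJ≢n : eJ J ≢ n → ∀ k →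
              + ePow G J k ≡ + eG G *ℤ ⌈ ℤtoℚ ((+ n) ^ℤ k - (+ eJ J) ^ℤ k) /ℚ ℤtoℚ (+ n - + eJ J) ⌉
  ePow-eJ≢n e≢n k = begin
    + ePow G J k
      ≡⟨ cong +_ (ePow≡eG*geometricSum k) ⟩
    + (eG G * geometricSum n e k)
      ≡⟨ ℤ.pos-* (eG G) _ ⟩
    + eG G *ℤ + geometricSum n e k
      ≡⟨ cong (+ eG G *ℤ_) (sym (ceiling-ℤtoℚ[d*i]/ℤtoℚd d _ d≢0)) ⟩
    + eG G *ℤ ⌈ ℤtoℚ (d *ℤ + geometricSum n e k) /ℚ ℤtoℚ d ⌉
      ≡⟨ cong (λ t → + eG G *ℤ ⌈ ℤtoℚ t /ℚ ℤtoℚ d ⌉) ([a-b]*geometricSum≡aᵏ-bᵏ n e k) ⟩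
    + eG G *ℤ ⌈ ℤtoℚ ((+ n) ^ℤ k - (+ e) ^ℤ k) /ℚ ℤtoℚ d ⌉
      ∎
    where
    open ≡-Reasoning
    e = eJ J
    d = + n - + e
    d≢0 : d ≢ + 0
    d≢0 d≡0 = e≢n (sym (ℤ.+-injective (ℤ.i-j≡0⇒i≡j (+ n) (+ e) d≡0)))

  ePow-eJ≡n : eJ J ≡ n → ∀ m → ePow G J (suc m) ≡ suc m * n ^ m * eG G
  ePow-eJ≡n e≡n m = begin
    ePow G J (suc m)                      ≡⟨ ePow≡eG*geometricSum (suc m) ⟩
    eG G * geometricSum n (eJ J) (suc m)  ≡⟨ cong (λ e → eG G * geometricSum n e (suc m)) e≡n ⟩
    eG G * geometricSum n n (suc m)       ≡⟨ cong (eG G *_) (geometricSum-diagonal n m) ⟩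
    eG G * (suc m * n ^ m)                ≡⟨ ℕ.*-comm (eG G) _ ⟩
    suc m * n ^ m * eG G                  ∎
    where open ≡-Reasoning

proposition2p1 : (n : ℕ) (G J : Adj n) → IsSimple G → IsSymmetricJ J →
    (k : ℕ) → 1 ≤ k →
      (eJ J ≢ n →
        + ePow G J k ≡ + eG G *ℤ ⌈ ℤtoℚ ((+ n) ^ℤ k - (+ eJ J) ^ℤ k) /ℚ ℤtoℚ (+ n - + eJ J) ⌉)
      × (eJ J ≡ n → ePow G J k ≡ k * n ^ (k ∸ 1) * eG G)
proposition2p1 n G J G-simple J-sym zero    ()
proposition2p1 n G J G-simple J-sym (suc m) _ =
  (λ e≢n → ePow-eJ≢n G J G-simple J-sym e≢n (suc m)) , (λ e≡n → ePow-eJ≡n G J G-simple J-sym e≡n m)
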